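{- Let $B=(G,S,C,f_0)$ be a minimal counterexample. If $e=uv$ is an edge of $G$ that does not join two vertices of $S$, then $|\mathrm{dom}(C_{uv})|\ge 2$. If additionally $e$ is not contained in a triangle, then $e$ is full in $C$.
   Context: All graphs are finite and simple; $[3]=\{1,2,3\}$. For a graph $G$ with a fixed orientation, a $3$-correspondence assignment is a function $C$ assigning to each directed edge $uv$ an injective, not necessarily total, function $C_{uv}:[3]\to[3]$; set $C_{vu}=C_{uv}^{ -1}$. An edge $uv$ is full if $\mathrm{dom}(C_{uv})=[3]$. A $C$-coloring of $G$ (or of a subgraph, using the restriction of $C$) is $f:V(G)\to[3]$ such that for every directed edge $uv$, $f(u)\notin\mathrm{dom}(C_{uv})$ or $C_{uv}(f(u))\ne f(v)$. For a walk $W=v_1\dots v_m$, $C_W$ is the partial function obtained by applying successively $C_{v_1v_2},\dots,C_{v_{m-1}v_m}$ (defined where all steps are defined); a closed walk $W$ ($v_1=v_m$) has length $m-1$ and $C$ is consistent on it if $C_W(c)=c$ for all $c\in\mathrm{dom}(C_W)$. A target is a quadruple $B=(G,S,C,f_0)$ where $G$ is a plane graph without cycles of lengths $4$ to $8$; $S\subseteq V(G)$ consists either of at most one vertex incident with the outer face of $G$ or of all vertices incident with the outer face of $G$; $|S|\le 12$; $C$ is a $3$-correspondence assignment for $G$ consistent on every closed walk of length three in $G$; and $f_0$ is a $C$-coloring of $G[S]$. A target is a counterexample if no $C$-coloring of $G$ restricts to $f_0$ on $S$. Let $e(B)=|E(G)|-|E(G[S])|$ and $s(B)=(|V(G)|,\,e(B),\,-\sum_{uv\in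 E(G)}|\mathrm{dom}(C_{uv})|)$. A minimal counterexample is a counterexample $B$ with $s(B)$ lexicographically minimum among all counterexamples. -}

module Defs where

open import Data.Nat using (ℕ; zero; suc; _+_; _*_; _∸_; _≤_; _<_; _≤ᵇ_; _<ᵇ_)
open import Data.Integer using (ℤ; +_; -_) renaming (_<_ to _<ℤ_)
open import Data.Bool using (Bool; true; false; _∧_; _∨_; if_then_else_)
open import Data.Fin using (Fin; zero; suc; toℕ; fromℕ; _≟_)
open import Data.Fin.Properties using () renaming (_≟_ to _≟F_)
open import Data.Maybe using (Maybe; just; nothing; is-just)
open import Data.Product using (Σ; ∃; ∃-syntax; _×_; _,_; proj₁; proj₂)
open import Data.Sum using (_⊎_; inj₁; inj₂)
open import Data.List using (List; []; _∷_; allFin; foldr; map)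
open import Data.List.Relation.Unary.All using (All)
open import Data.List.Relation.Unary.Any using (Any)
open import Data.List.Relation.Unary.AllPairs using (AllPairs)
open import Relation.Binary.PropositionalEquality using (_≡_)
open import Relation.Nullary using (¬_)
open import Relation.Nullary.Decidable using (⌊_⌋)
open import Function.Definitions using (Injective)

countB : ∀ {n} → (Fin n → Bool) → ℕ
countB {n} p = foldr (λ i acc → if p i then suc acc else acc) 0 (allFin n)

anyB : ∀ {n} → (Fin n → Bool) → Bool
anyB {n} p = foldr (λ i acc → p i ∨ acc) false (allFin n)

allB : ℕ → (ℕ → Bool) → Bool
allB zero    p = true
allB (suc k) p = p k ∧ allB k p

iter : ∀ {A : Set} → (A → A) → ℕ → A → A
iter f zero    a = a
iter f (suc k) a = f (iter f k a)

eqB : ∀ {n} → Fin n → Fin n → Bool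
eqB u v = ⌊ u ≟F v ⌋

-- Finite simple graphs on vertex set Fin n, given by a Boolean
-- adjacency relation (symmetry and irreflexivity are imposed in Target).

Adj : ℕ → Set
Adj n = Fin n → Fin n → Bool

reachB : ∀ {n} → Adj n → ℕ → Fin n → Fin n → Bool
reachB adj zero    u v = eqB u v
reachB adj (suc k) u v = reachB adj k u v ∨ anyB (λ w → reachB adj k u w ∧ adj w v)

conn : ∀ {n} → Adj n → Fin n → Fin n → Bool
conn {n} adj = reachB adj n

sumF : ∀ {n} → (Fin n → ℕ) → ℕ
sumF {n} f = foldr (λ i acc → f i + acc) 0 (allFin n)

countEdgesWith : ∀ {n} → Adj n → (Fin n → Fin n → Bool) → ℕ
countEdgesWith adj p =
  sumF (λ u → countB (λ v → (toℕ u <ᵇ toℕ v) ∧ adj u v ∧ p u v))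

sumEdges : ∀ {n} → Adj n → (Fin n → Fin n → ℕ) → ℕ
sumEdges adj w =
  sumF (λ u → sumF (λ v → if (toℕ u <ᵇ toℕ v) ∧ adj u v then w u v else 0))

-- Cycles.  A cycle of length suc m is an injective map c : Fin (suc m) → V
-- with c i ~ c (i+1) and c m ~ c 0.

IsCycle : ∀ {n} → Adj n → (m : ℕ) → (Fin (suc m) → Fin n) → Set
IsCycle adj m c =
  Injective _≡_ _≡_ c
  × (∀ i j → suc (toℕ i) ≡ toℕ j → adj (c i) (c j) ≡ true)
  × adj (c (fromℕ m)) (c zero) ≡ true

NoCycles4to8 : ∀ {n} → Adj n → Set
NoCycles4to8 {n} adj =
  ∀ m → 3 ≤ m → m ≤ 7 → (c : Fin (suc m) → Fin n) → ¬ IsCycle adj m c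

-- Plane embeddings, combinatorially (rotation systems).
-- rot u v = the neighbour of u following v in the clockwise order around u.
-- Darts are ordered pairs (u , v) with u ~ v; the face permutation is
-- φ (u , v) = (v , rot v u); faces are the φ-orbits of darts.

Dart : ℕ → Set
Dart n = Fin n × Fin n

φ : ∀ {n} → (Fin n → Fin n → Fin n) → Dart n → Dart n
φ rot (u , v) = (v , rot v u)

dartKey : ∀ {n} → Dart n → ℕ
dartKey {n} (u , v) = toℕ u * n + toℕ v

-- d is the least dart (w.r.t. dartKey) of its face (φ-orbit);
-- orbits have length ≤ n*n, so n*n iterations suffice
isFaceRep : ∀ {n} → (Fin n → Fin n → Fin n) → Dart n → Bool
isFaceRep {n} rot d = allB (n * n) (λ k → dartKey d ≤ᵇ dartKey (iter (φ rot) k d))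

-- number of faces of the component of r (an isolated vertex has one face)
facesOf : ∀ {n} → Adj n → (Fin n → Fin n → Fin n) → Fin n → ℕ
facesOf adj rot r =
  let F = sumF (λ u → countB (λ v → conn adj r u ∧ adj u v ∧ isFaceRep rot (u , v)))
      E = countEdgesWith adj (λ u v → conn adj r u)
  in if E Data.Nat.≡ᵇ 0 then 1 else F

-- seeds for the outer face: for each component on the outer face, either an
-- isolated vertex or a dart whose face is the outer face of that component
Seed : ℕ → Set
Seed n = Fin n ⊎ Dart n

seedVertex : ∀ {n} → Seed n → Fin n
seedVertex (inj₁ u)       = u
seedVertex (inj₂ (u , v)) = u

ValidSeed : ∀ {n} → Adj n → Seed n → Set
ValidSeed adj (inj₁ u)       = ∀ w → adj u w ≡ false
ValidSeed adj (inj₂ (u , v)) = adj u v ≡ true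

record PlaneEmbedding (n : ℕ) (adj : Adj n) : Set where
  field
    rot      : Fin n → Fin n → Fin n
    rot-adj  : ∀ u v → adj u v ≡ true → adj u (rot u v) ≡ true
    rot-cyc  : ∀ u v w → adj u v ≡ true → adj u w ≡ true →
               ∃[ k ] iter (rot u) k v ≡ w
    -- Euler's formula V - E + F = 2 for every component (genus 0)
    euler    : ∀ r → countB (conn adj r) + facesOf adj rot r
                     ≡ countEdgesWith adj (λ u v → conn adj r u) + 2
    seeds    : List (Seed n)
    seeds-ok : All (ValidSeed adj) seeds
    seeds-distinct : AllPairs (λ s t → conn adj (seedVertex s) (seedVertex t) ≡ false) seeds
    seeds-nonempty : 0 < n → ¬ (seeds ≡ [])

  OnSeedFace : Fin n → Seed n → Set
  OnSeedFace v (inj₁ u) = u ≡ v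
  OnSeedFace v (inj₂ d) = ∃[ k ] proj₁ (iter (φ rot) k d) ≡ v

  OnOuter : Fin n → Set
  OnOuter v = Any (OnSeedFace v) seeds

-- Colours [3] = Fin 3.  A partial function
-- [3] → [3] is Fin 3 → Maybe (Fin 3).  C u v is C_{uv} for every ordered
-- pair of adjacent vertices; C_{vu} = C_{uv}⁻¹ is imposed as a condition.

PFun : Set
PFun = Fin 3 → Maybe (Fin 3)

domSize : PFun → ℕ
domSize p = countB (λ c → is-just (p c))

Full : PFun → Set
Full p = ∀ c → ∃[ d ] p c ≡ just d

Corr : ℕ → Set
Corr n = Fin n → Fin n → PFun

-- f(u) = a, f(v) = b is allowed on the edge uv
Allowed : PFun → Fin 3 → Fin 3 → Set
Allowed p a b = ¬ (p a ≡ just b)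

record Target : Set where
  field
    n       : ℕ
    adj     : Adj n
    adj-sym : ∀ u v → adj u v ≡ adj v u
    adj-irr : ∀ u → adj u u ≡ false
    emb     : PlaneEmbedding n adj
    noCyc   : NoCycles4to8 adj
    S       : Fin n → Bool
    S-outer : (countB S ≤ 1 × (∀ v → S v ≡ true → PlaneEmbedding.OnOuter emb v))
              ⊎ (∀ v → (S v ≡ true → PlaneEmbedding.OnOuter emb v)
                       × (PlaneEmbedding.OnOuter emb v → S v ≡ true))
    S-size  : countB S ≤ 12
    C       : Corr n
    C-inj   : ∀ u v → adj u v ≡ true → ∀ a a' b →
              C u v a ≡ just b → C u v a' ≡ just b → a ≡ a'
    C-inv   : ∀ u v → adj u v ≡ true → ∀ a b → C u v a ≡ just b → C v u b ≡ just a
    C-tri   : ∀ a b c → adj a b ≡ true → adj b c ≡ true → adj c a ≡ true →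
              ∀ x y z w → C a b x ≡ just y → C b c y ≡ just z → C c a z ≡ just w → w ≡ x
    f0      : Fin n → Fin 3      -- only its values on S are relevant
    f0-col  : ∀ u v → adj u v ≡ true → S u ≡ true → S v ≡ true →
              Allowed (C u v) (f0 u) (f0 v)

open Target public

IsCColoring : (B : Target) → (Fin (n B) → Fin 3) → Set
IsCColoring B f = ∀ u v → adj B u v ≡ true → Allowed (C B u v) (f u) (f v)

Counterexample : Target → Set
Counterexample B =
  ¬ (∃[ f ] (IsCColoring B f × (∀ v → S B v ≡ true → f v ≡ f0 B v)))

eB : Target → ℕ
eB B = countEdgesWith (adj B) (λ u v → true)
       ∸ countEdgesWith (adj B) (λ u v → S B u ∧ S B v)

sB : Target → ℕ × ℕ × ℤ
sB B = n B , eB B , - (+ sumEdges (adj B) (λ u v → domSize (C B u v)))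

_<lex_ : ℕ × ℕ × ℤ → ℕ × ℕ × ℤ → Set
(a , b , c) <lex (a' , b' , c') =
  a < a' ⊎ (a ≡ a' × (b < b' ⊎ (b ≡ b' × c <ℤ c')))

MinimalCounterexample : Target → Set
MinimalCounterexample B =
  Counterexample B × (∀ B' → Counterexample B' → ¬ (sB B' <lex sB B))

InTriangle : (B : Target) → Fin (n B) → Fin (n B) → Set
InTriangle B u v = ∃[ w ] (adj B u w ≡ true × adj B v w ≡ true)

-- Let uv be an edge not inside S.  If a is a colour with C_uv(a)
-- undefined and b one with C_vu(b) undefined, adding the constraint a ↦ b
-- to uv yields a target B' whose colourings are colourings of B, so B' is
-- again a counterexample, and s(B') < s(B) because the domain sum grew.
-- This contradicts minimality provided B' is still a target, i.e. the new
-- constraint is consistent on every triangle through uv ("a and b are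
-- matched through t").
--   * If uv lies in no triangle, any such pair (a, b) works; a hole of C_uv
--     always yields a hole of C_vu, so C_uv is full.
--   * If uv lies in a triangle uvt, then t is unique (no 4-cycles).  Extending
--     the partial injections C_ut and C_vt to permutations shows that a
--     matched pair can be chosen avoiding any given colours a₀ at u and b₀ at
--     v; if |dom C_uv| ≤ 1, with C_uv ⊆ {a₀ ↦ b₀}, such a pair is a pair of
--     holes, a contradiction.

module Submission where

open import Defs
open import Data.Nat using (ℕ; zero; suc; _+_; _≤_; _<_; z≤n; s≤s; _<ᵇ_; _≤?_)
open import Data.Nat.Properties using (≤-pred; +-mono-≤; +-mono-<-≤; +-mono-≤-<; <⇒<ᵇ; 1+n≰n; ≰⇒>; <-cmp; suc-injective)
open import Data.Integer using (+<+)
open import Data.Integer.Properties using (neg-mono-<)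
open import Data.Bool using (Bool; true; false; _∧_; if_then_else_)
open import Data.Bool.Properties using () renaming (_≟_ to _≟ᵇ_)
open import Data.Fin using (Fin; zero; suc; toℕ; fromℕ; inject₁; _≟_; punchOut)
open import Data.Fin.Properties using (any?; all?; ¬∀⟶∃¬; punchOut-injective; injective⇒≤; toℕ-injective; toℕ-inject₁)
open import Data.Maybe using (Maybe; just; nothing; is-just)
open import Data.Maybe.Properties using (just-injective; ≡-dec)
open import Data.Product using (∃₂; ∃-syntax; _×_; _,_; proj₁; proj₂)
open import Data.Sum using (_⊎_; inj₁; inj₂)
open import Data.Empty using (⊥; ⊥-elim)
open import Data.List using (List; []; _∷_; allFin; foldr)
open import Data.List.Relation.Unary.All as All using (All; []; _∷_)
open import Data.List.Relation.Unary.Any using (here; there)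
open import Data.List.Membership.Propositional using (_∈_)
open import Data.List.Membership.Propositional.Properties using (∈-allFin)
open import Data.Vec using (Vec; lookup; []; _∷_)
open import Data.Vec.Relation.Unary.Unique.Propositional using (Unique)
open import Data.Vec.Relation.Unary.Unique.Propositional.Properties using (lookup-injective)
open import Data.Vec.Relation.Unary.AllPairs using ([]; _∷_)
open import Data.Vec.Relation.Unary.All using ([]; _∷_)
open import Relation.Binary.PropositionalEquality using (_≡_; _≢_; refl; sym; trans; cong; subst; module ≡-Reasoning)
open import Relation.Nullary using (¬_; Dec; yes; no)
open import Relation.Nullary.Decidable using (_×-dec_)
open import Function.Definitions using (Injective)
open import Relation.Binary using (tri<; tri≈; tri>)

PMap : ℕ → Set
PMap n = Fin n → Maybe (Fin n)

InjectiveP : ∀ {n} → PMap n → Set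
InjectiveP p = ∀ {c c' d} → p c ≡ just d → p c' ≡ just d → c ≡ c'

_⊆_ : ∀ {n} → PMap n → PMap n → Set
p ⊆ q = ∀ {c d} → p c ≡ just d → q c ≡ just d

Totalises : ∀ {n} → (Fin n → Fin n) → PMap n → Set
Totalises f p = ∀ {c d} → p c ≡ just d → f c ≡ d

_⊆⟨_↦_⟩ : ∀ {n} → PMap n → Fin n → Fin n → Set
p ⊆⟨ a₀ ↦ b₀ ⟩ = ∀ {c d} → p c ≡ just d → c ≡ a₀ × d ≡ b₀

-- An injective endomap of a finite set is surjective: a missed value z
-- would give an injection Fin (1 + n) → Fin n after punching out z.
injective⇒surjective : ∀ {n} (f : Fin n → Fin n) → Injective _≡_ _≡_ f →
                       ∀ z → ∃[ c ] f c ≡ z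
injective⇒surjective {suc n} f f-inj z with any? (λ c → f c ≟ z)
... | yes hit  = hit
... | no ¬hit = ⊥-elim (1+n≰n (injective⇒≤ squeeze-injective))
  where
  avoids : ∀ c → z ≢ f c
  avoids c z≡fc = ¬hit (c , sym z≡fc)

  squeeze-injective : Injective _≡_ _≡_ (λ c → punchOut (avoids c))
  squeeze-injective e = f-inj (punchOut-injective (avoids _) (avoids _) e)

value? : ∀ {n} (p : PMap n) z → Dec (∃[ c ] p c ≡ just z)
value? p z = any? (λ c → ≡-dec _≟_ (p c) (just z))

-- A partial endomap with a hole misses a value: if every value had a
-- preimage, the preimage map would be an injection, hence a surjection,
-- and would hit the hole.
hole⇒missed-value : ∀ {n} (p : PMap n) {a} → p a ≡ nothing → ∃[ z ] (∀ c → p c ≢ just z)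
hole⇒missed-value {n} p {a} hole with all? (value? p)
... | no ¬all = let (z , ¬hit) = ¬∀⟶∃¬ n _ (value? p) ¬all in z , λ c pc≡z → ¬hit (c , pc≡z)
... | yes preimage = hole-not-hit (injective⇒surjective g g-injective a)
  where
  g : Fin n → Fin n
  g z = proj₁ (preimage z)

  g-injective : Injective _≡_ _≡_ g
  g-injective {z} {z'} gz≡gz' =
    just-injective (trans (sym (proj₂ (preimage z))) (trans (cong p gz≡gz') (proj₂ (preimage z'))))

  hole-not-hit : ∃[ z ] g z ≡ a → ∃[ z ] (∀ c → p c ≢ just z)
  hole-not-hit (z , refl) with () ← trans (sym hole) (proj₂ (preimage z))

_[_↦_] : ∀ {n} → PMap n → Fin n → Fin n → PMap n
(p [ a ↦ d ]) c with c ≟ a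
... | yes _ = just d
... | no _  = p c

module _ {n} {p : PMap n} {a d : Fin n} where

  assign-here : (p [ a ↦ d ]) a ≡ just d
  assign-here with a ≟ a
  ... | yes _  = refl
  ... | no a≢a = ⊥-elim (a≢a refl)

  assign-extends : p a ≡ nothing → p ⊆ (p [ a ↦ d ])
  assign-extends hole {c} pc with c ≟ a
  ... | no _     = pc
  ... | yes refl with () ← trans (sym hole) pc

  assign-injective : InjectiveP p → (∀ c → p c ≢ just d) → InjectiveP (p [ a ↦ d ])
  assign-injective inj miss {c} {c'} e e' with c ≟ a | c' ≟ a
  ... | yes c≡a | yes c'≡a = trans c≡a (sym c'≡a)
  ... | yes _   | no _     = ⊥-elim (miss c' (trans e' (sym e)))
  ... | no _    | yes _    = ⊥-elim (miss c (trans e (sym e')))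
  ... | no _    | no _     = inj e e'

-- An injective partial map extends to an injective one defined on any given
-- list of points: fill the holes one at a time, each with a missed value.
fill : ∀ {n} (xs : List (Fin n)) (p : PMap n) → InjectiveP p →
       ∃[ q ] (InjectiveP q × p ⊆ q × All (λ c → ∃[ d ] q c ≡ just d) xs)
fill []       p inj = p , inj , (λ pc → pc) , []
fill (x ∷ xs) p inj with fill xs p inj
... | q , q-inj , p⊆q , defined with q x in qx
...   | just d  = q , q-inj , p⊆q , (d , qx) ∷ defined
...   | nothing =
  let (z , miss) = hole⇒missed-value q qx
      keep       = assign-extends {p = q} {a = x} {d = z} qx
  in  q [ x ↦ z ] , assign-injective {p = q} {a = x} q-inj miss , (λ pc → keep (p⊆q pc)) ,
      (z , assign-here {p = q} {a = x}) ∷ All.map (λ (d , qc) → d , keep qc) defined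

total-extension : ∀ {n} (p : PMap n) → InjectiveP p →
                  ∃[ f ] (Injective _≡_ _≡_ f × Totalises f p)
total-extension {n} p inj with fill (allFin n) p inj
... | q , q-inj , p⊆q , defined = f , f-injective , f-totalises
  where
  value : ∀ c → ∃[ d ] q c ≡ just d
  value c = All.lookup defined (∈-allFin c)

  f : Fin n → Fin n
  f c = proj₁ (value c)

  f-injective : Injective _≡_ _≡_ f
  f-injective {c} {c'} e = q-inj (proj₂ (value c)) (subst (λ d → q c' ≡ just d) (sym e) (proj₂ (value c')))

  f-totalises : Totalises f p
  f-totalises {c} pc = just-injective (trans (sym (proj₂ (value c))) (p⊆q pc))

-- With Q = C_ut and P = C_vt for a triangle uvt, the colours a at u and b at
-- v are matched through t when the constraint a ↦ b on uv is consistent with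
-- the triangle: they are seen at t as the same colour.
record Matched {n} (Q P : PMap n) (a b : Fin n) : Set where
  field
    forward  : ∀ {x y z} → Q x ≡ just z → P y ≡ just z → x ≡ a → y ≡ b
    backward : ∀ {x y z} → Q x ≡ just z → P y ≡ just z → y ≡ b → x ≡ a
    agree    : ∀ {z z'} → Q a ≡ just z → P b ≡ just z' → z ≡ z'

matched-by-totalisations :
  ∀ {n} {Q P : PMap n} {Q̂ P̂ : Fin n → Fin n} {a b} →
  Injective _≡_ _≡_ Q̂ → Injective _≡_ _≡_ P̂ → Totalises Q̂ Q → Totalises P̂ P →
  Q̂ a ≡ P̂ b → Matched Q P a b
matched-by-totalisations {Q̂ = Q̂} {P̂} {a} {b} Q̂-inj P̂-inj Q̂⊇Q P̂⊇P meet = record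
  { forward  = λ { {y = y} {z} qx py refl → P̂-inj (begin P̂ y ≡⟨ P̂⊇P py ⟩ z ≡⟨ sym (Q̂⊇Q qx) ⟩ Q̂ a ≡⟨ meet ⟩ P̂ b ∎) }
  ; backward = λ { {x = x} {z = z} qx py refl → Q̂-inj (begin Q̂ x ≡⟨ Q̂⊇Q qx ⟩ z ≡⟨ sym (P̂⊇P py) ⟩ P̂ b ≡⟨ sym meet ⟩ Q̂ a ∎) }
  ; agree    = λ qa pb → trans (sym (Q̂⊇Q qa)) (trans meet (P̂⊇P pb))
  }
  where open ≡-Reasoning

third-colour : (x y : Fin 3) → ∃[ z ] (z ≢ x × z ≢ y)
third-colour zero             zero             = suc zero , (λ ()) , (λ ())
third-colour zero             (suc zero)       = suc (suc zero) , (λ ()) , (λ ())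
third-colour zero             (suc (suc zero)) = suc zero , (λ ()) , (λ ())
third-colour (suc zero)       zero             = suc (suc zero) , (λ ()) , (λ ())
third-colour (suc zero)       (suc zero)       = zero , (λ ()) , (λ ())
third-colour (suc zero)       (suc (suc zero)) = zero , (λ ()) , (λ ())
third-colour (suc (suc zero)) zero             = suc zero , (λ ()) , (λ ())
third-colour (suc (suc zero)) (suc zero)       = zero , (λ ()) , (λ ())
third-colour (suc (suc zero)) (suc (suc zero)) = zero , (λ ()) , (λ ())

-- For partial injections on three colours, a matched pair can be chosen
-- avoiding any colour a₀ on the left and b₀ on the right: totalise both,
-- take a colour z other than Q̂ a₀ and P̂ b₀, and pull it back.
matched-pair-avoiding : (Q P : PFun) → InjectiveP Q → InjectiveP P → ∀ a₀ b₀ →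
                        ∃₂ λ a b → a ≢ a₀ × b ≢ b₀ × Matched Q P a b
matched-pair-avoiding Q P Q-inj P-inj a₀ b₀ =
  let (Q̂ , Q̂-inj , Q̂⊇Q) = total-extension Q Q-inj
      (P̂ , P̂-inj , P̂⊇P) = total-extension P P-inj
      (z , z≢Q̂a₀ , z≢P̂b₀) = third-colour (Q̂ a₀) (P̂ b₀)
      (a , Q̂a≡z) = injective⇒surjective Q̂ Q̂-inj z
      (b , P̂b≡z) = injective⇒surjective P̂ P̂-inj z
  in  a , b ,
      (λ a≡a₀ → z≢Q̂a₀ (trans (sym Q̂a≡z) (cong Q̂ a≡a₀))) ,
      (λ b≡b₀ → z≢P̂b₀ (trans (sym P̂b≡z) (cong P̂ b≡b₀))) ,
      matched-by-totalisations Q̂-inj P̂-inj Q̂⊇Q P̂⊇P (trans Q̂a≡z (sym P̂b≡z))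

full-or-hole : (p : PFun) → Full p ⊎ ∃[ a ] p a ≡ nothing
full-or-hole p with any? (λ c → ≡-dec _≟_ (p c) nothing)
... | yes hole = inj₂ hole
... | no ¬hole = inj₁ value
  where
  value : Full p
  value c with p c in pc
  ... | just d  = d , refl
  ... | nothing = ⊥-elim (¬hole (c , pc))

full⇒two-values : (p : PFun) → Full p → 2 ≤ domSize p
full⇒two-values p full
  rewrite proj₂ (full zero) | proj₂ (full (suc zero)) | proj₂ (full (suc (suc zero))) =
  s≤s (s≤s z≤n)

-- A correspondence with at most one constrained colour is contained in a
-- single pair a₀ ↦ b₀ (chosen arbitrarily when it is empty).
small-domain : (p : PFun) → domSize p ≤ 1 → ∃₂ λ a₀ b₀ → p ⊆⟨ a₀ ↦ b₀ ⟩
small-domain p small with p zero in p₀ | p (suc zero) in p₁ | p (suc (suc zero)) in p₂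
small-domain p (s≤s ()) | just _  | just _  | _
small-domain p (s≤s ()) | just _  | nothing | just _
small-domain p (s≤s ()) | nothing | just _  | just _
... | nothing | nothing | nothing = zero , zero , only
  where
  only : p ⊆⟨ zero ↦ zero ⟩
  only {zero}             e with () ← trans (sym p₀) e
  only {suc zero}         e with () ← trans (sym p₁) e
  only {suc (suc zero)}   e with () ← trans (sym p₂) e
... | just d  | nothing | nothing = zero , d , only
  where
  only : p ⊆⟨ zero ↦ d ⟩
  only {zero}             e = refl , just-injective (trans (sym e) p₀)
  only {suc zero}         e with () ← trans (sym p₁) e
  only {suc (suc zero)}   e with () ← trans (sym p₂) e
... | nothing | just d  | nothing = suc zero , d , only
  where
  only : p ⊆⟨ suc zero ↦ d ⟩
  only {zero}             e with () ← trans (sym p₀) e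
  only {suc zero}         e = refl , just-injective (trans (sym e) p₁)
  only {suc (suc zero)}   e with () ← trans (sym p₂) e
... | nothing | nothing | just d  = suc (suc zero) , d , only
  where
  only : p ⊆⟨ suc (suc zero) ↦ d ⟩
  only {zero}             e with () ← trans (sym p₀) e
  only {suc zero}         e with () ← trans (sym p₁) e
  only {suc (suc zero)}   e = refl , just-injective (trans (sym e) p₂)

-- Sums over a list, in the shape used by sumF.
sumL : ∀ {A : Set} → (A → ℕ) → List A → ℕ
sumL f = foldr (λ i acc → f i + acc) 0

module _ {A : Set} {f g : A → ℕ} (f≤g : ∀ i → f i ≤ g i) where

  sumL-mono : ∀ xs → sumL f xs ≤ sumL g xs
  sumL-mono []       = z≤n
  sumL-mono (x ∷ xs) = +-mono-≤ (f≤g x) (sumL-mono xs)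

  sumL-strict : ∀ {i} xs → i ∈ xs → f i < g i → sumL f xs < sumL g xs
  sumL-strict (x ∷ xs) (here refl) fi<gi = +-mono-<-≤ fi<gi (sumL-mono xs)
  sumL-strict (x ∷ xs) (there i∈xs) fi<gi = +-mono-≤-< (f≤g x) (sumL-strict xs i∈xs fi<gi)

indicator : Bool → ℕ
indicator b = if b then 1 else 0

count-as-sum : ∀ {A : Set} (p : A → Bool) xs →
               foldr (λ i acc → if p i then suc acc else acc) 0 xs ≡ sumL (λ i → indicator (p i)) xs
count-as-sum p []       = refl
count-as-sum p (x ∷ xs) with p x
... | true  = cong suc (count-as-sum p xs)
... | false = count-as-sum p xs

indicator-is-just : ∀ {n} {p q : PMap n} → p ⊆ q → ∀ c → indicator (is-just (p c)) ≤ indicator (is-just (q c))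
indicator-is-just {p = p} {q} p⊆q c with p c in pc
... | nothing = z≤n
... | just d rewrite p⊆q pc = s≤s z≤n

domSize-as-sum : (p : PFun) → domSize p ≡ sumL (λ c → indicator (is-just (p c))) (allFin 3)
domSize-as-sum p = count-as-sum (λ c → is-just (p c)) (allFin 3)

domSize-strict : {p q : PFun} → p ⊆ q → ∀ {c d} → p c ≡ nothing → q c ≡ just d → domSize p < domSize q
domSize-strict {p} {q} p⊆q {c} pc qc
  rewrite domSize-as-sum p | domSize-as-sum q =
  sumL-strict (indicator-is-just {p = p} {q} p⊆q) (allFin 3) (∈-allFin c) new-value
  where
  new-value : indicator (is-just (p c)) < indicator (is-just (q c))
  new-value rewrite pc | qc = s≤s z≤n

domSize-mono : {p q : PFun} → p ⊆ q → domSize p ≤ domSize q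
domSize-mono {p} {q} p⊆q
  rewrite domSize-as-sum p | domSize-as-sum q =
  sumL-mono (indicator-is-just {p = p} {q} p⊆q) (allFin 3)

module _ {n} (adj : Adj n) {w w' : Fin n → Fin n → ℕ} (w≤w' : ∀ x y → w x y ≤ w' x y) where

  edge-weight : (Fin n → Fin n → ℕ) → Fin n → Fin n → ℕ
  edge-weight ω s t = if (toℕ s <ᵇ toℕ t) ∧ adj s t then ω s t else 0

  edge-weight-mono : ∀ s t → edge-weight w s t ≤ edge-weight w' s t
  edge-weight-mono s t with (toℕ s <ᵇ toℕ t) ∧ adj s t
  ... | true  = w≤w' s t
  ... | false = z≤n

  edge-weight-strict : ∀ {s t} → toℕ s < toℕ t → adj s t ≡ true →
                       w s t < w' s t → edge-weight w s t < edge-weight w' s t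
  edge-weight-strict {s} {t} s<t st with toℕ s <ᵇ toℕ t | <⇒<ᵇ s<t
  ... | true | _ rewrite st = λ lt → lt

  sumEdges-strict-oriented : ∀ {s t} → toℕ s < toℕ t → adj s t ≡ true →
                             w s t < w' s t → sumEdges adj w < sumEdges adj w'
  sumEdges-strict-oriented {s} {t} s<t st lt =
    sumL-strict (λ r → sumL-mono (edge-weight-mono r) (allFin n)) (allFin n) (∈-allFin s)
      (sumL-strict (edge-weight-mono s) (allFin n) (∈-allFin t) (edge-weight-strict s<t st lt))

  sumEdges-strict : ∀ {x y} → x ≢ y → adj x y ≡ true → adj y x ≡ true →
                    w x y < w' x y → w y x < w' y x → sumEdges adj w < sumEdges adj w'
  sumEdges-strict {x} {y} x≢y xy yx xy< yx< with <-cmp (toℕ x) (toℕ y)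
  ... | tri< x<y _ _ = sumEdges-strict-oriented x<y xy xy<
  ... | tri≈ _ x≡y _ = ⊥-elim (x≢y (toℕ-injective x≡y))
  ... | tri> _ _ y<x = sumEdges-strict-oriented y<x yx yx<

successor : ∀ {m} {i j : Fin (suc m)} → suc (toℕ i) ≡ toℕ j → ∃[ k ] (i ≡ inject₁ k × j ≡ suc k)
successor {j = suc k} i+1≡j = k , toℕ-injective (trans (suc-injective i+1≡j) (sym (toℕ-inject₁ k))) , refl

closed-walk-cycle : ∀ {n m} (adj : Adj n) (vs : Vec (Fin n) (suc m)) → Unique vs →
                    (∀ k → adj (lookup vs (inject₁ k)) (lookup vs (suc k)) ≡ true) →
                    adj (lookup vs (fromℕ m)) (lookup vs zero) ≡ true → IsCycle adj m (lookup vs)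
closed-walk-cycle adj vs distinct steps closing = (λ {i} {j} → lookup-injective distinct i j) , step , closing
  where
  step : ∀ i j → suc (toℕ i) ≡ toℕ j → adj (lookup vs i) (lookup vs j) ≡ true
  step i j i+1≡j with successor i+1≡j
  ... | k , refl , refl = steps k

module _ (B : Target) where

  adj-flip : ∀ {x y} → adj B x y ≡ true → adj B y x ≡ true
  adj-flip {x} {y} xy = trans (sym (adj-sym B x y)) xy

  adj⇒≢ : ∀ {x y} → adj B x y ≡ true → x ≢ y
  adj⇒≢ {x} xx refl with () ← trans (sym (adj-irr B x)) xx

  -- An edge lies in at most one triangle: two would give a 4-cycle u t v t'.
  common-neighbour-unique : ∀ {u v t t'} → adj B u v ≡ true →
                            adj B u t ≡ true → adj B v t ≡ true →
                            adj B u t' ≡ true → adj B v t' ≡ true → t ≡ t'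
  common-neighbour-unique {u} {v} {t} {t'} uv ut vt ut' vt' with t ≟ t'
  ... | yes t≡t' = t≡t'
  ... | no t≢t' =
    ⊥-elim (noCyc B 3 three≤ three≤ (lookup square)
             (closed-walk-cycle (adj B) square distinct steps (adj-flip ut')))
    where
    three≤ : ∀ {m} → 3 ≤ 3 + m
    three≤ = s≤s (s≤s (s≤s z≤n))

    square : Vec (Fin (n B)) 4
    square = u ∷ t ∷ v ∷ t' ∷ []

    distinct : Unique square
    distinct = (adj⇒≢ ut ∷ adj⇒≢ uv ∷ adj⇒≢ ut' ∷ [])
             ∷ ((λ t≡v → adj⇒≢ vt (sym t≡v)) ∷ t≢t' ∷ [])
             ∷ (adj⇒≢ vt' ∷ [])
             ∷ [] ∷ []

    steps : ∀ k → adj B (lookup square (inject₁ k)) (lookup square (suc k)) ≡ true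
    steps zero             = ut
    steps (suc zero)       = adj-flip vt
    steps (suc (suc zero)) = vt'

  C-injective : ∀ {s t} → adj B s t ≡ true → InjectiveP (C B s t)
  C-injective {s} {t} st = C-inj B s t st _ _ _

  -- A hole of C_uv gives a hole of C_vu: C_uv misses some value b.
  inverse-hole : ∀ {u v a} → adj B u v ≡ true → C B u v a ≡ nothing → ∃[ b ] C B v u b ≡ nothing
  inverse-hole {u} {v} uv hole with hole⇒missed-value (C B u v) hole
  ... | b , missed with C B v u b in vu
  ...   | nothing = b , vu
  ...   | just c  = ⊥-elim (missed c (C-inv B v u (adj-flip uv) b c vu))

module Strengthening (B : Target) {u v : Fin (n B)} {a b : Fin 3}
  (uv : adj B u v ≡ true) (uv⊄S : ¬ (S B u ≡ true × S B v ≡ true))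
  (hole-uv : C B u v a ≡ nothing) (hole-vu : C B v u b ≡ nothing)
  (matched : ∀ t → adj B u t ≡ true → adj B v t ≡ true → Matched (C B u t) (C B v t) a b) where

  u≢v : u ≢ v
  u≢v = adj⇒≢ B uv

  data New (x y : Fin (n B)) (c d : Fin 3) : Set where
    forth : x ≡ u → y ≡ v → c ≡ a → d ≡ b → New x y c d
    back  : x ≡ v → y ≡ u → c ≡ b → d ≡ a → New x y c d

  added : Fin (n B) → Fin (n B) → Fin 3 → Maybe (Fin 3)
  added x y c with (x ≟ u) ×-dec ((y ≟ v) ×-dec (c ≟ a))
  ... | yes _ = just b
  ... | no _ with (x ≟ v) ×-dec ((y ≟ u) ×-dec (c ≟ b))
  ...   | yes _ = just a
  ...   | no _  = nothing

  -- C with the new values filled in (they only land on holes of C)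
  C' : Corr (n B)
  C' x y c with C B x y c
  ... | just d  = just d
  ... | nothing = added x y c

  added-new : ∀ x y c d → added x y c ≡ just d → New x y c d
  added-new x y c d e with (x ≟ u) ×-dec ((y ≟ v) ×-dec (c ≟ a))
  ... | yes (x≡u , y≡v , c≡a) = forth x≡u y≡v c≡a (sym (just-injective e))
  ... | no _ with (x ≟ v) ×-dec ((y ≟ u) ×-dec (c ≟ b))
  ...   | yes (x≡v , y≡u , c≡b) = back x≡v y≡u c≡b (sym (just-injective e))
  added-new x y c d () | no _ | no _

  C'-split : ∀ {x y c d} → C' x y c ≡ just d → C B x y c ≡ just d ⊎ New x y c d
  C'-split {x} {y} {c} {d} e with C B x y c
  ... | just _  = inj₁ e
  ... | nothing = inj₂ (added-new x y c d e)

  C⊆C' : ∀ x y → C B x y ⊆ C' x y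
  C⊆C' x y e rewrite e = refl

  C'-at-hole : ∀ {x y c} → C B x y c ≡ nothing → C' x y c ≡ added x y c
  C'-at-hole {x} {y} {c} hole with C B x y c
  ... | nothing = refl

  C'-forth : C' u v a ≡ just b
  C'-forth = trans (C'-at-hole hole-uv) forth-added
    where
    forth-added : added u v a ≡ just b
    forth-added with (u ≟ u) ×-dec ((v ≟ v) ×-dec (a ≟ a))
    ... | yes _ = refl
    ... | no ¬p = ⊥-elim (¬p (refl , refl , refl))

  C'-back : C' v u b ≡ just a
  C'-back = trans (C'-at-hole hole-vu) back-added
    where
    back-added : added v u b ≡ just a
    back-added with (v ≟ u) ×-dec ((u ≟ v) ×-dec (b ≟ a))
    ... | yes (v≡u , _) = ⊥-elim (u≢v (sym v≡u))
    ... | no _ with (v ≟ v) ×-dec ((u ≟ u) ×-dec (b ≟ b))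
    ...   | yes _ = refl
    ...   | no ¬p = ⊥-elim (¬p (refl , refl , refl))

  -- an old constraint never clashes with a new one, as a and b were holes
  old-new : ∀ {x y c c' d} → C B x y c ≡ just d → New x y c' d → ⊥
  old-new {c = c} old (forth refl refl refl refl) with () ← trans (sym hole-vu) (C-inv B u v uv c b old)
  old-new {c = c} old (back refl refl refl refl) with () ← trans (sym hole-uv) (C-inv B v u (adj-flip B uv) c a old)

  C'-injective : ∀ x y → adj B x y ≡ true → ∀ c c' d → C' x y c ≡ just d → C' x y c' ≡ just d → c ≡ c'
  C'-injective x y xy c c' d e e' with C'-split e | C'-split e'
  ... | inj₁ old | inj₁ old' = C-inj B x y xy c c' d old old'
  ... | inj₁ old | inj₂ new  = ⊥-elim (old-new old new)
  ... | inj₂ new | inj₁ old  = ⊥-elim (old-new old new)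
  ... | inj₂ (forth _ _ c≡a _) | inj₂ (forth _ _ c'≡a _) = trans c≡a (sym c'≡a)
  ... | inj₂ (back _ _ c≡b _)  | inj₂ (back _ _ c'≡b _)  = trans c≡b (sym c'≡b)
  ... | inj₂ (forth x≡u _ _ _) | inj₂ (back x≡v _ _ _)   = ⊥-elim (u≢v (trans (sym x≡u) x≡v))
  ... | inj₂ (back x≡v _ _ _)  | inj₂ (forth x≡u _ _ _)  = ⊥-elim (u≢v (trans (sym x≡u) x≡v))

  C'-inverse : ∀ x y → adj B x y ≡ true → ∀ c d → C' x y c ≡ just d → C' y x d ≡ just c
  C'-inverse x y xy c d e with C'-split e
  ... | inj₁ old = C⊆C' y x (C-inv B x y xy c d old)
  ... | inj₂ (forth refl refl refl refl) = C'-back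
  ... | inj₂ (back refl refl refl refl)  = C'-forth

  -- the new constraint lies outside G[S], so f₀ stays a colouring of G[S]
  f0-colouring : ∀ x y → adj B x y ≡ true → S B x ≡ true → S B y ≡ true → Allowed (C' x y) (f0 B x) (f0 B y)
  f0-colouring x y xy Sx Sy e with C'-split e
  ... | inj₁ old = f0-col B x y xy Sx Sy old
  ... | inj₂ (forth refl refl _ _) = uv⊄S (Sx , Sy)
  ... | inj₂ (back refl refl _ _)  = uv⊄S (Sy , Sx)

  consecutive-new : ∀ {p q r x y y' z} → New p q x y → New q r y' z → p ≡ r
  consecutive-new (forth p≡u _ _ _) (back _ r≡u _ _)  = trans p≡u (sym r≡u)
  consecutive-new (back p≡v _ _ _)  (forth _ r≡v _ _) = trans p≡v (sym r≡v)
  consecutive-new (forth _ q≡v _ _) (forth q≡u _ _ _) = ⊥-elim (u≢v (trans (sym q≡u) q≡v))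
  consecutive-new (back _ q≡u _ _)  (back q≡v _ _ _)  = ⊥-elim (u≢v (trans (sym q≡u) q≡v))

  -- C' is consistent on triangles: a triangle contains at most one new dart,
  -- and then its third vertex t is a common neighbour of u and v, where the
  -- new pair is matched.
  C'-triangle : ∀ p q r → adj B p q ≡ true → adj B q r ≡ true → adj B r p ≡ true →
                ∀ x y z w → C' p q x ≡ just y → C' q r y ≡ just z → C' r p z ≡ just w → w ≡ x
  C'-triangle p q r pq qr rp x y z w e₁ e₂ e₃ = closes (C'-split e₁) (C'-split e₂) (C'-split e₃)
    where
    open Matched
    inv : ∀ {s t c d} → adj B s t ≡ true → C B s t c ≡ just d → C B t s d ≡ just c
    inv st = C-inv B _ _ st _ _

    closes : C B p q x ≡ just y ⊎ New p q x y → C B q r y ≡ just z ⊎ New q r y z →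
             C B r p z ≡ just w ⊎ New r p z w → w ≡ x
    closes (inj₁ o₁) (inj₁ o₂) (inj₁ o₃) = C-tri B p q r pq qr rp x y z w o₁ o₂ o₃
    closes (inj₂ n₁) (inj₂ n₂) _         = ⊥-elim (adj⇒≢ B rp (sym (consecutive-new n₁ n₂)))
    closes _         (inj₂ n₂) (inj₂ n₃) = ⊥-elim (adj⇒≢ B pq (sym (consecutive-new n₂ n₃)))
    closes (inj₂ n₁) _         (inj₂ n₃) = ⊥-elim (adj⇒≢ B qr (sym (consecutive-new n₃ n₁)))
    closes (inj₂ (forth refl refl refl refl)) (inj₁ o₂) (inj₁ o₃) =
      backward (matched r (adj-flip B rp) qr) (inv rp o₃) o₂ refl
    closes (inj₂ (back refl refl refl refl)) (inj₁ o₂) (inj₁ o₃) =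
      forward (matched r qr (adj-flip B rp)) o₂ (inv rp o₃) refl
    closes (inj₁ o₁) (inj₂ (forth refl refl refl refl)) (inj₁ o₃) =
      sym (agree (matched p (adj-flip B pq) rp) (inv pq o₁) o₃)
    closes (inj₁ o₁) (inj₂ (back refl refl refl refl)) (inj₁ o₃) =
      agree (matched p rp (adj-flip B pq)) o₃ (inv pq o₁)
    closes (inj₁ o₁) (inj₁ o₂) (inj₂ (forth refl refl refl refl)) =
      sym (forward (matched q (adj-flip B qr) pq) (inv qr o₂) o₁ refl)
    closes (inj₁ o₁) (inj₁ o₂) (inj₂ (back refl refl refl refl)) =
      sym (backward (matched q pq (adj-flip B qr)) o₁ (inv qr o₂) refl)

  B' : Target
  B' = record
    { n = n B ; adj = adj B ; adj-sym = adj-sym B ; adj-irr = adj-irr B ; emb = emb B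
    ; noCyc = noCyc B ; S = S B ; S-outer = S-outer B ; S-size = S-size B
    ; C = C' ; C-inj = C'-injective ; C-inv = C'-inverse ; C-tri = C'-triangle
    ; f0 = f0 B ; f0-col = f0-colouring }

  -- C' only adds constraints, so a C'-colouring is a C-colouring
  still-counterexample : Counterexample B → Counterexample B'
  still-counterexample no-colouring (f , colouring , extends) =
    no-colouring (f , (λ x y xy clash → colouring x y xy (C⊆C' x y clash)) , extends)

  smaller : sB B' <lex sB B
  smaller = inj₂ (refl , inj₂ (refl , neg-mono-< (+<+ domain-sum-grows)))
    where
    domain-sum-grows : sumEdges (adj B) (λ x y → domSize (C B x y)) < sumEdges (adj B) (λ x y → domSize (C' x y))
    domain-sum-grows =
      sumEdges-strict (adj B) (λ x y → domSize-mono {C B x y} {C' x y} (C⊆C' x y)) u≢v uv (adj-flip B uv)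
        (domSize-strict {C B u v} {C' u v} (C⊆C' u v) hole-uv C'-forth)
        (domSize-strict {C B v u} {C' v u} (C⊆C' v u) hole-vu C'-back)

  not-minimal : ¬ MinimalCounterexample B
  not-minimal (counterexample , minimal) = minimal B' (still-counterexample counterexample) smaller

module MinimalEdge (B : Target) (minimal : MinimalCounterexample B) {u v : Fin (n B)}
  (uv : adj B u v ≡ true) (uv⊄S : ¬ (S B u ≡ true × S B v ≡ true)) where

  no-matched-holes : ∀ {a b} → C B u v a ≡ nothing → C B v u b ≡ nothing →
                     (∀ t → adj B u t ≡ true → adj B v t ≡ true → Matched (C B u t) (C B v t) a b) → ⊥
  no-matched-holes hole-uv hole-vu matched =
    Strengthening.not-minimal B uv uv⊄S hole-uv hole-vu matched minimal

  full-outside-triangles : ¬ InTriangle B u v → Full (C B u v)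
  full-outside-triangles no-triangle with full-or-hole (C B u v)
  ... | inj₁ full = full
  ... | inj₂ (a , hole-uv) =
    let (b , hole-vu) = inverse-hole B uv hole-uv
    in  ⊥-elim (no-matched-holes hole-uv hole-vu (λ t ut vt → ⊥-elim (no-triangle (t , ut , vt))))

  -- If C_uv ⊆ {a₀ ↦ b₀}, a pair (a, b) avoiding a₀ and b₀ is a pair of holes;
  -- matched through a triangle uvt, it is matched through every triangle on
  -- uv, as t is the only common neighbour.
  matched-avoiding-pair-impossible :
    ∀ {t a₀ b₀} → adj B u t ≡ true → adj B v t ≡ true → C B u v ⊆⟨ a₀ ↦ b₀ ⟩ →
    (∃₂ λ a b → a ≢ a₀ × b ≢ b₀ × Matched (C B u t) (C B v t) a b) → ⊥
  matched-avoiding-pair-impossible {t} ut vt within (a , b , a≢a₀ , b≢b₀ , ab-matched) =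
    no-matched-holes hole-uv hole-vu matched-everywhere
    where
    hole-uv : C B u v a ≡ nothing
    hole-uv with C B u v a in e
    ... | nothing = refl
    ... | just _  = ⊥-elim (a≢a₀ (proj₁ (within e)))

    hole-vu : C B v u b ≡ nothing
    hole-vu with C B v u b in e
    ... | nothing = refl
    ... | just c  = ⊥-elim (b≢b₀ (proj₂ (within (C-inv B v u (adj-flip B uv) b c e))))

    matched-everywhere : ∀ t' → adj B u t' ≡ true → adj B v t' ≡ true → Matched (C B u t') (C B v t') a b
    matched-everywhere t' ut' vt' =
      subst (λ s → Matched (C B u s) (C B v s) a b) (common-neighbour-unique B uv ut vt ut' vt') ab-matched

  sparse-triangle-edge : ∀ {t} → adj B u t ≡ true → adj B v t ≡ true → domSize (C B u v) ≤ 1 → ⊥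
  sparse-triangle-edge {t} ut vt small =
    let (a₀ , b₀ , within) = small-domain (C B u v) small
    in  matched-avoiding-pair-impossible ut vt within
          (matched-pair-avoiding (C B u t) (C B v t) (C-injective B ut) (C-injective B vt) a₀ b₀)

  -- Either uv lies in a triangle, or C_uv is full.
  at-least-two-values : 2 ≤ domSize (C B u v)
  at-least-two-values with 2 ≤? domSize (C B u v)
  ... | yes two = two
  ... | no ¬two with any? (λ t → (adj B u t ≟ᵇ true) ×-dec (adj B v t ≟ᵇ true))
  ...   | yes (t , ut , vt) = ⊥-elim (sparse-triangle-edge ut vt (≤-pred (≰⇒> ¬two)))
  ...   | no no-triangle    = full⇒two-values (C B u v) (full-outside-triangles no-triangle)

lemma7 : (B : Target) → MinimalCounterexample B →
         ∀ u v → adj B u v ≡ true → ¬ (S B u ≡ true × S B v ≡ true) →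
         (2 ≤ domSize (C B u v)) × (¬ InTriangle B u v → Full (C B u v))
lemma7 B minimal u v uv uv⊄S = at-least-two-values , full-outside-triangles
  where open MinimalEdge B minimal uv uv⊄S
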